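{- Let $N$ be a positive integer and let $I,J$ be disjoint sets with $I\cup J=[N]=\{1,\ldots,N\}$. Then $$\prod_{\substack{i_1<i_2\\ i_1,i_2\in I}}[i_2-i_1]_q=\prod_{\substack{j_1<j_2\\ j_1,j_2\in J}}[j_2-j_1]_q\cdot\frac{\prod_{i=1}^{N-1}[i]_q!}{\prod_{j\in J}[j-1]_q!\cdot\prod_{j\in J}[N-j]_q!}.$$
   Context: $[k]_q=\frac{1-q^k}{1-q}$ for positive integers $k$, $[k]_q!=[k]_q[k-1]_q\cdots[1]_q$, and $[0]_q!=1$. Empty products equal $1$. -}

module Defs where

open import Data.Nat using (ℕ; zero; suc; _∸_)
open import Data.Fin using (Fin; zero; suc; toℕ; _<?_)
open import Data.Fin.Subset using (Subset)
open import Data.Vec using (lookup)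
open import Data.Bool using (Bool; true; false; if_then_else_; _∧_)
open import Relation.Nullary.Decidable using (⌊_⌋)
open import Algebra.Bundles using (CommutativeRing)

module QDefs {c ℓ} (R : CommutativeRing c ℓ) where
  open CommutativeRing R using (Carrier; 0#; 1#; _+_; _*_)

  qint : Carrier → ℕ → Carrier
  qint q zero    = 0#
  qint q (suc k) = 1# + q * qint q k

  qfact : Carrier → ℕ → Carrier
  qfact q zero    = 1#
  qfact q (suc k) = qint q (suc k) * qfact q k

  prodFin : ∀ {n} → (Fin n → Carrier) → Carrier
  prodFin {zero}  f = 1#
  prodFin {suc n} f = f zero * prodFin (λ i → f (suc i))

  prodSubset : ∀ {n} → Subset n → (Fin n → Carrier) → Carrier
  prodSubset S f = prodFin (λ a → if lookup S a then f a else 1#)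

  -- ∏_{a<b, a,b ∈ S} [b - a]_q   (element a : Fin N stands for toℕ a + 1 ∈ [N])
  pairProd : ∀ {n} → Carrier → Subset n → Carrier
  pairProd q S = prodFin (λ a → prodFin (λ b →
    if (lookup S a ∧ lookup S b ∧ ⌊ a <? b ⌋) then qint q (toℕ b ∸ toℕ a) else 1#))

{-# OPTIONS --safe #-}
-- With positions 0-indexed (a, b ∈ {0, …, N−1}), write [b]! = ∏_{a<b} [b−a] and
-- [N−1−a]! = ∏_{a<b<N} [b−a].  Then both sides are products of the factors [b−a] over pairs
-- a < b, with multiplicities.  On the left a pair is counted [a,b ∈ I] + [b ∈ J] + [a ∈ J]
-- times, on the right [a,b ∈ J] + 1 times, and these agree because J is the complement of I.
-- Finally the product over all pairs is ∏_{b<N} [b]! = ∏_{i=1}^{N−1} [i]!.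
module Submission where

open import Defs
open import Data.Nat using (ℕ; zero; suc; _∸_; _≤_)
open import Data.Fin using (Fin; zero; suc; toℕ; _<?_; inject₁; fromℕ)
open import Data.Fin.Subset using (Subset; _∩_; _∪_; ⊥; ⊤)
open import Relation.Binary.PropositionalEquality using (_≡_)
open import Algebra.Bundles using (CommutativeRing; CommutativeMonoid)

open import Data.Fin.Properties using (toℕ-inject₁; toℕ-fromℕ)
open import Data.Bool using (true; false; if_then_else_; _∧_; _∨_; not)
open import Data.Bool.Properties using (if-∧; if-cong; ∧-assoc)
open import Data.Vec using (lookup)
open import Data.Vec.Properties using (lookup-zipWith; lookup-replicate)
open import Relation.Nullary.Decidable using (⌊_⌋; isYes≗does)
import Relation.Binary.PropositionalEquality as ≡
import Relation.Binary.Reasoning.Setoid as SetoidReasoning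
import Algebra.Properties.CommutativeMonoid.Sum as MonoidSum

lookup-complement : ∀ {n} (I J : Subset n) → I ∩ J ≡ ⊥ → I ∪ J ≡ ⊤ →
                    ∀ a → lookup J a ≡ not (lookup I a)
lookup-complement I J I∩J≡⊥ I∪J≡⊤ a = complement (lookup I a) (lookup J a) disjoint covering
  where
  disjoint : lookup I a ∧ lookup J a ≡ false
  disjoint = ≡.trans (≡.sym (lookup-zipWith _∧_ a I J))
               (≡.trans (≡.cong (λ S → lookup S a) I∩J≡⊥) (lookup-replicate a false))
  covering : lookup I a ∨ lookup J a ≡ true
  covering = ≡.trans (≡.sym (lookup-zipWith _∨_ a I J))
               (≡.trans (≡.cong (λ S → lookup S a) I∪J≡⊤) (lookup-replicate a true))
  complement : ∀ x y → x ∧ y ≡ false → x ∨ y ≡ true → y ≡ not x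
  complement true  false _ _ = ≡.refl
  complement false true  _ _ = ≡.refl

module FinProducts {c ℓ} (M : CommutativeMonoid c ℓ) where
  open CommutativeMonoid M renaming (_∙_ to _*_; ε to 1#)
  open MonoidSum M public using () renaming
    ( sum to ∏; sum-cong-≋ to ∏-cong; sum-cong-≗ to ∏-cong-≗; ∑-distrib-+ to ∏-distrib-*
    ; ∑-comm to ∏-comm; sum-init-last to ∏-init-last; sum-replicate-zero to ∏-replicate-1)

  ∏-syntax : ∀ n → (Fin n → Carrier) → Carrier
  ∏-syntax _ = ∏

  syntax ∏-syntax n (λ i → x) = ∏[ i < n ] x

  ∏₂ : ∀ {m n} → (Fin m → Fin n → Carrier) → Carrier
  ∏₂ {m} {n} f = ∏[ a < m ] ∏[ b < n ] f a b

  ∏₂-cong : ∀ {m n} {f g : Fin m → Fin n → Carrier} → (∀ a b → f a b ≈ g a b) → ∏₂ f ≈ ∏₂ g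
  ∏₂-cong {m} {n} f≈g = ∏-cong {m} (λ a → ∏-cong {n} (f≈g a))

  ∏₂-distrib-* : ∀ {m n} (f g : Fin m → Fin n → Carrier) →
                 ∏₂ (λ a b → f a b * g a b) ≈ ∏₂ f * ∏₂ g
  ∏₂-distrib-* {m} f g =
    trans (∏-cong {m} (λ a → ∏-distrib-* (f a) (g a))) (∏-distrib-* (λ a → ∏ (f a)) (λ a → ∏ (g a)))

  if-then-∏ : ∀ {n} t {x} {f : Fin n → Carrier} → x ≈ ∏ f →
              (if t then x else 1#) ≈ ∏[ i < n ] (if t then f i else 1#)
  if-then-∏ true  x≈∏f = x≈∏f
  if-then-∏ {n} false _ = sym (∏-replicate-1 n)

  pair-multiplicity : ∀ xa xb {ya yb} → ya ≡ not xa → yb ≡ not xb → ∀ v →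
    (if xa ∧ xb then v else 1#) * ((if yb then v else 1#) * (if ya then v else 1#))
      ≈ (if ya ∧ yb then v else 1#) * v
  pair-multiplicity true  true  ≡.refl ≡.refl v =
    trans (∙-congˡ (identityˡ 1#)) (trans (identityʳ v) (sym (identityˡ v)))
  pair-multiplicity true  false ≡.refl ≡.refl v = ∙-congˡ (identityʳ v)
  pair-multiplicity false true  ≡.refl ≡.refl v = ∙-congˡ (identityˡ v)
  pair-multiplicity false false ≡.refl ≡.refl v = identityˡ _

module QGaps {c ℓ} (R : CommutativeRing c ℓ) (q : CommutativeRing.Carrier R) where
  open CommutativeRing R hiding (zero)
  open QDefs R
  open FinProducts *-commutativeMonoid public
  open SetoidReasoning setoid

  prodFin≡∏ : ∀ {n} (f : Fin n → Carrier) → prodFin f ≡ ∏ f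
  prodFin≡∏ {zero}  f = ≡.refl
  prodFin≡∏ {suc n} f = ≡.cong (f zero *_) (prodFin≡∏ (λ i → f (suc i)))

  qgap : ∀ {n} → Fin n → Fin n → Carrier
  qgap a b = if ⌊ a <? b ⌋ then qint q (toℕ b ∸ toℕ a) else 1#

  qgap-zeroʳ : ∀ {n} (a : Fin (suc n)) → qgap a zero ≡ 1#
  qgap-zeroʳ {n} a = if-cong {x = qint q 0} (isYes≗does (a <? zero {n}))

  qgap-zero-suc : ∀ {n} (b : Fin n) → qgap zero (suc b) ≡ qint q (suc (toℕ b))
  qgap-zero-suc {n} b = if-cong {y = 1#} (isYes≗does (zero {n} <? suc b))

  qgap-suc : ∀ {n} (a b : Fin n) → qgap (suc a) (suc b) ≡ qgap a b
  qgap-suc a b = if-cong (≡.trans (isYes≗does (suc a <? suc b)) (≡.sym (isYes≗does (a <? b))))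

  bothEndsIn leftEndIn rightEndIn : ∀ {n} → Subset n → Fin n → Fin n → Carrier
  bothEndsIn S a b = if lookup S a ∧ lookup S b then qgap a b else 1#
  leftEndIn  S a b = if lookup S a then qgap a b else 1#
  rightEndIn S a b = if lookup S b then qgap a b else 1#

  pairProd≡∏₂ : ∀ {n} (S : Subset n) → pairProd q S ≡ ∏₂ (bothEndsIn S)
  pairProd≡∏₂ {n} S = ≡.trans (prodFin≡∏ {n} _) (∏-cong-≗ {n} λ a →
    ≡.trans (prodFin≡∏ (summand a)) (∏-cong-≗ {n} (regroup a)))
    where
    summand : Fin n → Fin n → Carrier
    summand a b = if lookup S a ∧ lookup S b ∧ ⌊ a <? b ⌋ then qint q (toℕ b ∸ toℕ a) else 1#
    regroup : ∀ a b → summand a b ≡ bothEndsIn S a b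
    regroup a b = ≡.trans (if-cong (≡.sym (∧-assoc (lookup S a) (lookup S b) ⌊ a <? b ⌋)))
                          (if-∧ (lookup S a ∧ lookup S b))

  qfact≈∏qint : ∀ m → qfact q m ≈ ∏[ i < m ] qint q (suc (toℕ i))
  qfact≈∏qint zero    = refl
  qfact≈∏qint (suc m) = begin
    qint q (suc m) * qfact q m                       ≈⟨ *-comm _ _ ⟩
    qfact q m * qint q (suc m)                       ≈⟨ *-cong (trans (qfact≈∏qint m) (∏-cong {m} λ i →
                                                          reflexive (≡.cong [1+_] (≡.sym (toℕ-inject₁ i)))))
                                                          (reflexive (≡.cong [1+_] (≡.sym (toℕ-fromℕ m)))) ⟩
    ∏[ i < m ] [1+ toℕ (inject₁ i) ] * [1+ toℕ (fromℕ m) ]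
                                                     ≈⟨ ∏-init-last {m} (λ i → [1+ toℕ i ]) ⟨
    ∏[ i < suc m ] [1+ toℕ i ]                       ∎
    where
    [1+_] : ℕ → Carrier
    [1+ k ] = qint q (suc k)

  qfact≈∏-qgap-below : ∀ {n} (j : Fin n) → qfact q (toℕ j) ≈ ∏[ a < n ] qgap a j
  qfact≈∏-qgap-below {suc n} zero    =
    sym (trans (∏-cong {suc n} (λ a → reflexive (qgap-zeroʳ a))) (∏-replicate-1 (suc n)))
  qfact≈∏-qgap-below {suc n} (suc j) = begin
    qint q (suc (toℕ j)) * qfact q (toℕ j)       ≈⟨ *-congˡ (qfact≈∏-qgap-below j) ⟩
    qint q (suc (toℕ j)) * ∏[ a < n ] qgap a j   ≡⟨ ≡.cong₂ _*_ (≡.sym (qgap-zero-suc j))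
                                                      (∏-cong-≗ {n} (λ a → ≡.sym (qgap-suc a j))) ⟩
    qgap zero (suc j) * ∏[ a < n ] qgap (suc a) (suc j) ∎

  qfact≈∏-qgap-above : ∀ {n} (j : Fin n) → qfact q (n ∸ suc (toℕ j)) ≈ ∏[ b < n ] qgap j b
  qfact≈∏-qgap-above {suc n} zero    = begin
    qfact q n                                    ≈⟨ qfact≈∏qint n ⟩
    ∏[ b < n ] qint q (suc (toℕ b))              ≈⟨ *-identityˡ _ ⟨
    1# * ∏[ b < n ] qint q (suc (toℕ b))         ≡⟨ ≡.cong₂ _*_ (≡.sym (qgap-zeroʳ (zero {n})))
                                                      (∏-cong-≗ {n} (λ b → ≡.sym (qgap-zero-suc b))) ⟩
    qgap (zero {n}) zero * ∏[ b < n ] qgap zero (suc b) ∎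
  qfact≈∏-qgap-above {suc n} (suc j) = begin
    qfact q (n ∸ suc (toℕ j))                    ≈⟨ qfact≈∏-qgap-above j ⟩
    ∏[ b < n ] qgap j b                          ≈⟨ *-identityˡ _ ⟨
    1# * ∏[ b < n ] qgap j b                     ≡⟨ ≡.cong₂ _*_ (≡.sym (qgap-zeroʳ (suc j)))
                                                      (∏-cong-≗ {n} (λ b → ≡.sym (qgap-suc j b))) ⟩
    qgap (suc j) zero * ∏[ b < n ] qgap (suc j) (suc b) ∎

  ∏-qfact≈∏₂-qgap : ∀ {n} → ∏[ b < n ] qfact q (toℕ b) ≈ ∏₂ (qgap {n})
  ∏-qfact≈∏₂-qgap {n} = trans (∏-cong {n} qfact≈∏-qgap-below) (∏-comm {n} {n} (λ b a → qgap a b))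

  prodSubset-qfact-below : ∀ {n} (S : Subset n) →
                           prodSubset S (λ j → qfact q (toℕ j)) ≈ ∏₂ (rightEndIn S)
  prodSubset-qfact-below {n} S = begin
    prodSubset S (λ j → qfact q (toℕ j))                  ≡⟨ prodFin≡∏ {n} _ ⟩
    ∏[ b < n ] (if lookup S b then qfact q (toℕ b) else 1#) ≈⟨ ∏-cong {n} (λ b →
                                                               if-then-∏ {n} (lookup S b) (qfact≈∏-qgap-below b)) ⟩
    ∏[ b < n ] ∏[ a < n ] rightEndIn S a b                ≈⟨ ∏-comm {n} {n} (λ b a → rightEndIn S a b) ⟩
    ∏₂ (rightEndIn S)                                     ∎

  prodSubset-qfact-above : ∀ {n} (S : Subset n) →
                           prodSubset S (λ j → qfact q (n ∸ suc (toℕ j))) ≈ ∏₂ (leftEndIn S)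
  prodSubset-qfact-above {n} S = trans (reflexive (prodFin≡∏ {n} _))
    (∏-cong {n} (λ a → if-then-∏ {n} (lookup S a) (qfact≈∏-qgap-above a)))

  ∏-qfact-shift : ∀ n → prodFin {n ∸ 1} (λ i → qfact q (suc (toℕ i))) ≈ ∏[ b < n ] qfact q (toℕ b)
  ∏-qfact-shift zero    = refl
  ∏-qfact-shift (suc n) = trans (reflexive (prodFin≡∏ {n} _)) (sym (*-identityˡ _))

lemma4p2 : ∀ {c ℓ} (R : CommutativeRing c ℓ) (q : CommutativeRing.Carrier R)
    (N : ℕ) → 1 ≤ N → (I J : Subset N) → I ∩ J ≡ ⊥ → I ∪ J ≡ ⊤ →
    let open CommutativeRing R
        open QDefs R
    in pairProd q I * (prodSubset J (λ j → qfact q (toℕ j)) * prodSubset J (λ j → qfact q (N ∸ suc (toℕ j))))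
       ≈ pairProd q J * prodFin {N ∸ 1} (λ i → qfact q (suc (toℕ i)))
lemma4p2 R q N _ I J I∩J≡⊥ I∪J≡⊤ = begin
  pairProd q I * (prodSubset J (λ j → qfact q (toℕ j)) * prodSubset J (λ j → qfact q (N ∸ suc (toℕ j))))
    ≈⟨ *-cong (reflexive (pairProd≡∏₂ I)) (*-cong (prodSubset-qfact-below J) (prodSubset-qfact-above J)) ⟩
  ∏₂ (bothEndsIn I) * (∏₂ (rightEndIn J) * ∏₂ (leftEndIn J))
    ≈⟨ *-congˡ (∏₂-distrib-* (rightEndIn J) (leftEndIn J)) ⟨
  ∏₂ (bothEndsIn I) * ∏₂ (λ a b → rightEndIn J a b * leftEndIn J a b)
    ≈⟨ ∏₂-distrib-* (bothEndsIn I) (λ a b → rightEndIn J a b * leftEndIn J a b) ⟨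
  ∏₂ (λ a b → bothEndsIn I a b * (rightEndIn J a b * leftEndIn J a b))
    ≈⟨ ∏₂-cong {N} {N} (λ a b → pair-multiplicity (lookup I a) (lookup I b) (J≡∁I a) (J≡∁I b) (qgap a b)) ⟩
  ∏₂ (λ a b → bothEndsIn J a b * qgap a b)
    ≈⟨ ∏₂-distrib-* (bothEndsIn J) (qgap {N}) ⟩
  ∏₂ (bothEndsIn J) * ∏₂ (qgap {N})
    ≈⟨ *-cong (reflexive (≡.sym (pairProd≡∏₂ J))) (sym (∏-qfact≈∏₂-qgap {N})) ⟩
  pairProd q J * ∏[ b < N ] qfact q (toℕ b)
    ≈⟨ *-congˡ (∏-qfact-shift N) ⟨
  pairProd q J * prodFin {N ∸ 1} (λ i → qfact q (suc (toℕ i))) ∎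
  where
  open CommutativeRing R
  open QDefs R
  open QGaps R q
  open SetoidReasoning setoid
  J≡∁I : ∀ a → lookup J a ≡ not (lookup I a)
  J≡∁I = lookup-complement I J I∩J≡⊥ I∪J≡⊤
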